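{- Let $A$ be an $n\times m$ toroidal partially filled array in which every row and every column contains at least one filled cell, and let $|F(A)|$ be its number of filled cells. If $P(A)$ has a solution, then: 1) $A$ is a minimal closed subarray, i.e. the only closed subarray $\mathcal{R}\cap\mathcal{C}$ of $A$ containing at least one filled cell is $A$ itself; 2) $|F(A)|\equiv m+n-1 \pmod 2$.
   Context: Arrays are toroidal: an $n\times m$ array $A$ has rows indexed modulo $n$ and columns modulo $m$ (representatives $1,\dots,n$ and $1,\dots,m$). Each cell is either filled or empty, and $F(A)\subseteq[1,n]\times[1,m]$ is the set of filled cells. For $(i,j)\in F(A)$: - the row successor $s_r((i,j))$ is $(i,j+k)$ with $k\ge1$ minimal such that $(i,j+k)\in F(A)$; - the column successor $s_c((i,j))$ is $(i+k,j)$ with $k\ge1$ minimal such that $(i+k,j)\in F(A)$. Both are permutations of $F(A)$. Given $R=(r_1,\dots,r_n)\in\{ -1,1\}^n$ and $C=(c_1,\dots,c_m)\in\{ -1,1\}^m$, the move function $S_{R,C}:F(A)\to F(A)$ is $S_{R,C}((i,j))=s_c^{\,c_{j'}}((i,j'))$, where $(i,j')=s_r^{\,r_i}((i,j))$; an exponent $-1$ means the inverse permutation. For $(i,j)\in F(A)$, let $L(i,j)=((i,j),S_{R,C}((i,j)),\dots,S_{R,C}^p((i,j)))$, where $p\ge0$ is minimal with $S_{R,C}^{p+1}((i,j))=(i,j)$. The pair $R,C$ is a solution of $P(A)$ if $L(i,j)$ covers all of $F(A)$ for some (equivalently every) filled $(i,j)$, i.e. $S_{R,C}$ is a single cycle on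 $F(A)$. "$P(A)$ has a solution" means such $R,C$ exist. Closed subarrays: for a list $\mathcal{R}$ of rows and a list $\mathcal{C}$ of columns of $A$, the subarray $\mathcal{R}\cap\mathcal{C}$ is closed if $F(\mathcal{R}\cap\mathcal{C})=F(\mathcal{R}\cup\mathcal{C})$. This means every filled cell lying in a row of $\mathcal{R}$ or a column of $\mathcal{C}$ lies in both. A closed subarray is minimal if it is minimal with respect to inclusion. -}

module Defs where

open import Data.Bool using (Bool; true; false; if_then_else_)
open import Data.Nat using (ℕ; zero; suc; _+_; _*_; _≤_; _<_)
open import Data.Fin as Fin using (Fin; toℕ)
open import Data.Product using (Σ; ∃; ∃-syntax; _×_; _,_)
open import Data.Sum using (_⊎_)
open import Data.Sign as Sg using (Sign)
open import Data.Fin.Subset using (Subset; _∈_)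
open import Relation.Binary.PropositionalEquality using (_≡_)
open import Relation.Nullary using (¬_)

-- An n × m partially filled array: A i j ≡ true iff cell (i,j) is filled.
Array : ℕ → ℕ → Set
Array n m = Fin n → Fin m → Bool

Cell : ℕ → ℕ → Set
Cell n m = Fin n × Fin m

Filled : ∀ {n m} → Array n m → Cell n m → Set
Filled A (i , j) = A i j ≡ true

-- Toroidal shift: b represents a + k modulo the size (b is a Fin, so < size).
ShiftMod : ∀ {s} → Fin s → ℕ → Fin s → Set
ShiftMod {s} a k b = ∃[ q ] (toℕ a + k ≡ toℕ b + q * s)

RowSucc : ∀ {n m} → Array n m → Cell n m → Cell n m → Set
RowSucc A (i , j) (i' , j') =
  (i' ≡ i) × A i j ≡ true × A i j' ≡ true ×
  ∃[ k ] (1 ≤ k × ShiftMod j k j' ×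
          (∀ k' (j'' : _) → 1 ≤ k' → k' < k → ShiftMod j k' j'' → ¬ (A i j'' ≡ true)))

ColSucc : ∀ {n m} → Array n m → Cell n m → Cell n m → Set
ColSucc A (i , j) (i' , j') =
  (j' ≡ j) × A i j ≡ true × A i' j ≡ true ×
  ∃[ k ] (1 ≤ k × ShiftMod i k i' ×
          (∀ k' (i'' : _) → 1 ≤ k' → k' < k → ShiftMod i k' i'' → ¬ (A i'' j ≡ true)))

-- Apply a permutation given as a (functional) relation with exponent +1 or -1
-- (exponent -1 = inverse permutation = converse relation).
Pow± : ∀ {X : Set} → (X → X → Set) → Sign → X → X → Set
Pow± S Sg.+ x y = S x y
Pow± S Sg.- x y = S y x

Move : ∀ {n m} → Array n m → (Fin n → Sign) → (Fin m → Sign) → Cell n m → Cell n m → Set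
Move A R C (i , j) q =
  ∃[ j' ] (Pow± (RowSucc A) (R i) (i , j) (i , j') × Pow± (ColSucc A) (C j') (i , j') q)

data Iter {X : Set} (S : X → X → Set) : ℕ → X → X → Set where
  iter-zero : ∀ {x} → Iter S zero x x
  iter-suc  : ∀ {t x y z} → S x y → Iter S t y z → Iter S (suc t) x z

IsSolution : ∀ {n m} → Array n m → (Fin n → Sign) → (Fin m → Sign) → Set
IsSolution A R C =
  ∃[ x ] (Filled A x × (∀ y → Filled A y → ∃[ t ] Iter (Move A R C) t x y))

HasSolution : ∀ {n m} → Array n m → Set
HasSolution {n} {m} A = ∃[ R ] ∃[ C ] IsSolution {n} {m} A R C

Closed : ∀ {n m} → Array n m → Subset n → Subset m → Set
Closed A Rs Cs = ∀ i j → A i j ≡ true → (i ∈ Rs ⊎ j ∈ Cs) → (i ∈ Rs × j ∈ Cs)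

∑ : ∀ {k} → (Fin k → ℕ) → ℕ
∑ {zero} f = 0
∑ {suc k} f = f Fin.zero + ∑ (λ i → f (Fin.suc i))

numFilled : ∀ {n m} → Array n m → ℕ
numFilled A = ∑ (λ i → ∑ (λ j → if A i j then 1 else 0))

-- Minimality.  A move of S_{R,C} goes along a row to a filled cell and then
-- along that cell's column to another filled cell; so for a closed subarray
-- Rs ∩ Cs the start of a move lies in a row of Rs iff its end does.  The single
-- orbit of a solution passes through every filled cell, in particular one of
-- the subarray, hence only through rows of Rs: so Rs contains every row, and by
-- closedness Cs contains every column.
--
-- Parity.  As a permutation of the cells, S_{R,C} = κ ∘ ρ, where ρ runs every
-- row's filled cells cyclically (forwards or backwards according to R) and κ
-- does the same along the columns.  A line with c filled cells contributes a
-- c-cycle, of sign c - 1, so sgn ρ = |F| - n and sgn κ = |F| - m (mod 2).  A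
-- solution makes S_{R,C} a single |F|-cycle, of sign |F| - 1, and
-- multiplicativity of the sign gives |F| - 1 ≡ (|F| - m) + (|F| - n).

module Submission where

open import Defs
open import Algebra.Bundles using (CommutativeRing)
import Algebra.Properties.CommutativeMonoid.Sum as MonoidSum
open import Data.Bool using (Bool; true; false; not; _∧_; _xor_; if_then_else_)
open import Data.Bool.Properties
  using (xor-∧-commutativeRing; xor-assoc; xor-comm; xor-same; ∧-zeroʳ; ∧-distribˡ-xor; ∧-distribʳ-xor;
         xor-annihilates-not; not-involutive; not-distribˡ-xor; not-distribʳ-xor)
  renaming (_≟_ to _≟ᵇ_)
open import Data.Nat using (ℕ; zero; suc; _+_; _*_; _∸_; _≤_; _<_; z≤n; s≤s; _%_; _/_; _<ᵇ_)
open import Data.Nat.Properties as ℕP using ()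
open import Data.Nat.DivMod using (m≡m%n+[m/n]*n; m%n<n; [m+kn]%n≡m%n; [m+n]%n≡m%n; m<n⇒m%n≡m)
open import Data.Nat.GeneralisedArithmetic using (iterate)
open import Data.Fin using (Fin; zero; suc; toℕ; combine; remQuot)
open import Data.Fin.Properties using (toℕ-injective; toℕ<n; _≟_; suc-injective; remQuot-combine; combine-remQuot)
open import Data.Fin.Permutation as FinPerm using (Permutation′; permutation; _⟨$⟩ʳ_; _⟨$⟩ˡ_; _∘ₚ_)
open import Data.Fin.Subset using (Subset; _∈_)
open import Data.Sign as Sg using (Sign)
open import Data.Product using (∃-syntax; _×_; _,_; proj₁; proj₂)
open import Data.Sum using (_⊎_; inj₁; inj₂)
open import Data.Empty using (⊥-elim)
open import Data.List using (List; []; _∷_; length; map; concat; filter; tabulate; allFin; applyUpTo)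
open import Data.List.Properties using (length-map; length-++)
open import Data.List.Membership.Propositional using () renaming (_∈_ to _∈ₗ_; _∉_ to _∉ₗ_)
open import Data.List.Membership.Propositional.Properties
  using (∈-filter⁺; ∈-filter⁻; ∈-allFin; ∈-applyUpTo⁻; ∈-map⁺; ∈-map⁻; ∈-concat⁺′; ∈-concat⁻′; ∈-tabulate⁺; ∈-tabulate⁻)
open import Data.List.Membership.Propositional.Properties.WithK using (unique∧set⇒bag)
open import Data.List.Relation.Unary.Any using (here; there)
open import Data.List.Relation.Unary.All as All using (_∷_)
import Data.List.Relation.Unary.All.Properties as Allₚ
open import Data.List.Relation.Unary.AllPairs as AllPairs using (AllPairs; _∷_)
import Data.List.Relation.Unary.AllPairs.Properties as AllPairsₚ
open import Data.List.Relation.Unary.Unique.Propositional using (Unique)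
open import Data.List.Relation.Unary.Unique.Propositional.Properties as Uniqueₚ
  using (Unique[x∷xs]⇒x∉xs; applyUpTo⁺₁)
open import Data.List.Relation.Binary.Disjoint.Propositional using (Disjoint)
open import Data.List.Relation.Binary.BagAndSetEquality using (∼bag⇒↭)
open import Data.List.Relation.Binary.Permutation.Propositional.Properties using (↭-length)
open import Function using (_∘_; id)
open import Function.Bundles using (mk⇔)
open import Relation.Binary.Definitions using (DecidableEquality; tri<; tri≈; tri>)
open import Relation.Binary.PropositionalEquality
open import Relation.Nullary using (¬_; yes; no; Dec)
open import Relation.Nullary.Decidable using (map′)

Injective : ∀ {A B : Set} → (A → B) → Set
Injective f = ∀ {x y} → f x ≡ f y → x ≡ y

∑-cong : ∀ {k} {f g : Fin k → ℕ} → (∀ i → f i ≡ g i) → ∑ f ≡ ∑ g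
∑-cong {zero}  f≗g = refl
∑-cong {suc k} f≗g = cong₂ _+_ (f≗g zero) (∑-cong (f≗g ∘ suc))

-- ∑ is the library's sum for the monoid (ℕ, +, 0), which lets us exchange the
-- order of a double sum.
module ℕΣ = MonoidSum ℕP.+-0-commutativeMonoid

∑≡sum : ∀ {k} (f : Fin k → ℕ) → ∑ f ≡ ℕΣ.sum f
∑≡sum {zero}  f = refl
∑≡sum {suc k} f = cong (f zero +_) (∑≡sum (f ∘ suc))

∑-comm : ∀ {a b} (f : Fin a → Fin b → ℕ) → ∑ (λ i → ∑ (f i)) ≡ ∑ (λ j → ∑ (λ i → f i j))
∑-comm f = begin
    ∑ (λ i → ∑ (f i))                   ≡⟨ as-sum (λ i → ∑ (f i)) f (λ i → ∑≡sum (f i)) ⟩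
    ℕΣ.sum (λ i → ℕΣ.sum (f i))         ≡⟨ ℕΣ.∑-comm f ⟩
    ℕΣ.sum (λ j → ℕΣ.sum (λ i → f i j)) ≡⟨ sym (as-sum (λ j → ∑ (λ i → f i j)) (λ j i → f i j)
                                                          (λ j → ∑≡sum (λ i → f i j))) ⟩
    ∑ (λ j → ∑ (λ i → f i j))           ∎
  where
    open ≡-Reasoning
    as-sum : ∀ {a b} (g : Fin a → ℕ) (h : Fin a → Fin b → ℕ) → (∀ i → g i ≡ ℕΣ.sum (h i)) →
             ∑ g ≡ ℕΣ.sum (λ i → ℕΣ.sum (h i))
    as-sum g h g≡ = trans (∑≡sum g) (ℕΣ.sum-cong-≗ g≡)

-- The parity of a natural number, as a bit; bits are added with xor.
odd : ℕ → Bool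
odd zero    = false
odd (suc n) = not (odd n)

odd-+ : ∀ a b → odd (a + b) ≡ odd a xor odd b
odd-+ zero    b = refl
odd-+ (suc a) b = trans (cong not (odd-+ a b)) (not-distribˡ-xor (odd a) (odd b))

odd-+∸1 : ∀ m n → 1 ≤ n → odd (m + n ∸ 1) ≡ not (odd m xor odd n)
odd-+∸1 m (suc n) _ = begin
    odd (m + suc n ∸ 1)         ≡⟨ cong (λ k → odd (k ∸ 1)) (ℕP.+-suc m n) ⟩
    odd (m + n)                 ≡⟨ odd-+ m n ⟩
    odd m xor odd n             ≡⟨ cong (odd m xor_) (sym (not-involutive (odd n))) ⟩
    odd m xor not (not (odd n)) ≡⟨ sym (not-distribʳ-xor (odd m) (not (odd n))) ⟩
    not (odd m xor odd (suc n)) ∎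
  where open ≡-Reasoning

%2≡odd : ∀ k → k % 2 ≡ (if odd k then 1 else 0)
%2≡odd zero          = refl
%2≡odd (suc zero)    = refl
%2≡odd (suc (suc k)) = trans (cong (_% 2) (ℕP.+-comm 2 k)) (trans ([m+n]%n≡m%n k 2)
  (trans (%2≡odd k) (cong (λ b → if b then 1 else 0) (sym (not-involutive (odd k))))))

same-parity⇒%2 : ∀ {a b} → odd a ≡ odd b → a % 2 ≡ b % 2
same-parity⇒%2 {a} {b} e = trans (%2≡odd a) (trans (cong (λ c → if c then 1 else 0) e) (sym (%2≡odd b)))

xor≡false⇒≡ : ∀ a b → a xor b ≡ false → a ≡ b
xor≡false⇒≡ false false _ = refl
xor≡false⇒≡ true  true  _ = refl

xor-cancelˡ : ∀ a b → a xor (a xor b) ≡ b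
xor-cancelˡ a b = trans (sym (xor-assoc a a b)) (cong (_xor b) (xor-same a))

xor-swapˡ : ∀ a b c → a xor (b xor c) ≡ b xor (a xor c)
xor-swapˡ a b c = trans (sym (xor-assoc a b c)) (trans (cong (_xor c) (xor-comm a b)) (xor-assoc b a c))

xor-telescope : ∀ a b c → (a xor b) xor (b xor c) ≡ a xor c
xor-telescope a b c = trans (xor-assoc a b (b xor c)) (cong (a xor_) (xor-cancelˡ b c))

module ⊕ = MonoidSum (CommutativeRing.+-commutativeMonoid xor-∧-commutativeRing)

⨁ : ∀ {k} → (Fin k → Bool) → Bool
⨁ = ⊕.sum

⨁-cong : ∀ {k} {f g : Fin k → Bool} → (∀ i → f i ≡ g i) → ⨁ f ≡ ⨁ g
⨁-cong = ⊕.sum-cong-≗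

⨁-false : ∀ k → ⨁ {k} (λ _ → false) ≡ false
⨁-false = ⊕.sum-replicate-zero

⨁-even : ∀ {k} (f : Fin k → ℕ) → ⨁ (λ i → not (odd (f i))) ≡ odd k xor odd (∑ f)
⨁-even {zero}  f = refl
⨁-even {suc k} f = begin
    not (odd (f zero)) xor ⨁ (λ i → not (odd (f (suc i))))
  ≡⟨ cong (not (odd (f zero)) xor_) (⨁-even (f ∘ suc)) ⟩
    not (odd (f zero)) xor (odd k xor odd (∑ (f ∘ suc)))
  ≡⟨ sym (not-distribˡ-xor (odd (f zero)) _) ⟩
    not (odd (f zero) xor (odd k xor odd (∑ (f ∘ suc))))
  ≡⟨ cong not (xor-swapˡ (odd (f zero)) (odd k) _) ⟩
    not (odd k xor (odd (f zero) xor odd (∑ (f ∘ suc))))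
  ≡⟨ cong (λ b → not (odd k xor b)) (sym (odd-+ (f zero) (∑ (f ∘ suc)))) ⟩
    not (odd k xor odd (∑ f))
  ≡⟨ not-distribˡ-xor (odd k) _ ⟩
    not (odd k) xor odd (∑ f)
  ∎
  where open ≡-Reasoning

-- A symmetric bit matrix with zero diagonal has even total weight, since its
-- off-diagonal entries come in equal pairs.  This drives the multiplicativity of
-- the sign below.
⨁⨁-symmetric : ∀ {k} (K : Fin k → Fin k → Bool) →
               (∀ x y → K x y ≡ K y x) → (∀ x → K x x ≡ false) →
               ⨁ (λ x → ⨁ (K x)) ≡ false
⨁⨁-symmetric {zero}  K sym-K diag = refl
⨁⨁-symmetric {suc k} K sym-K diag = begin
    (K zero zero xor row) xor ⨁ (λ x → K (suc x) zero xor ⨁ (λ y → K (suc x) (suc y)))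
  ≡⟨ cong₂ _xor_ (cong (_xor row) (diag zero)) (⊕.∑-distrib-+ (λ x → K (suc x) zero) _) ⟩
    row xor (⨁ (λ x → K (suc x) zero) xor rest)
  ≡⟨ cong (λ c → row xor (c xor rest)) (⨁-cong (λ x → sym-K (suc x) zero)) ⟩
    row xor (row xor rest)
  ≡⟨ xor-cancelˡ row rest ⟩
    rest
  ≡⟨ ⨁⨁-symmetric (λ x y → K (suc x) (suc y)) (λ x y → sym-K (suc x) (suc y)) (diag ∘ suc) ⟩
    false
  ∎
  where
    open ≡-Reasoning
    row  = ⨁ (λ y → K zero (suc y))
    rest = ⨁ (λ x → ⨁ (λ y → K (suc x) (suc y)))

ltᵇ-irrefl : ∀ n → (n <ᵇ n) ≡ false
ltᵇ-irrefl zero    = refl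
ltᵇ-irrefl (suc n) = ltᵇ-irrefl n

ltᵇ-flip : ∀ x y → ¬ x ≡ y → (y <ᵇ x) ≡ not (x <ᵇ y)
ltᵇ-flip zero    zero    x≢y = ⊥-elim (x≢y refl)
ltᵇ-flip zero    (suc y) x≢y = refl
ltᵇ-flip (suc x) zero    x≢y = refl
ltᵇ-flip (suc x) (suc y) x≢y = ltᵇ-flip x y (x≢y ∘ cong suc)

module _ {N : ℕ} where

  lt : Fin N → Fin N → Bool
  lt a b = toℕ a <ᵇ toℕ b

  lt-irrefl : ∀ a → lt a a ≡ false
  lt-irrefl a = ltᵇ-irrefl (toℕ a)

  lt-flip : ∀ {a b} → ¬ a ≡ b → lt b a ≡ not (lt a b)
  lt-flip {a} {b} a≢b = ltᵇ-flip (toℕ a) (toℕ b) (a≢b ∘ toℕ-injective)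

  Δ : (Fin N → Fin N) → (Fin N → Fin N) → Fin N → Fin N → Bool
  Δ f g a b = lt (f a) (f b) xor lt (g a) (g b)

  Δ-symmetric : ∀ {f g} → Injective f → Injective g → ∀ a b → Δ f g a b ≡ Δ f g b a
  Δ-symmetric {f} {g} f-inj g-inj a b with a ≟ b
  ... | yes refl = refl
  ... | no a≢b = sym (begin
      lt (f b) (f a) xor lt (g b) (g a)
    ≡⟨ cong₂ _xor_ (lt-flip (a≢b ∘ f-inj)) (lt-flip (a≢b ∘ g-inj)) ⟩
      not (lt (f a) (f b)) xor not (lt (g a) (g b))
    ≡⟨ xor-annihilates-not (lt (f a) (f b)) _ ⟩
      lt (f a) (f b) xor lt (g a) (g b)
    ∎)
    where open ≡-Reasoning

  Δ-diagonal : ∀ f g a → Δ f g a a ≡ false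
  Δ-diagonal f g a = cong₂ _xor_ (lt-irrefl (f a)) (lt-irrefl (g a))

  -- The sign of h : Fin N → Fin N is the parity of its number of inversions.
  sgn : (Fin N → Fin N) → Bool
  sgn h = ⨁ (λ a → ⨁ (λ b → lt a b ∧ Δ id h a b))

  sgn-cong : ∀ {f g} → (∀ x → f x ≡ g x) → sgn f ≡ sgn g
  sgn-cong f≗g = ⨁-cong (λ a → ⨁-cong (λ b →
    cong₂ (λ u v → lt a b ∧ (lt a b xor lt u v)) (f≗g a) (f≗g b)))

  sgn-id : sgn id ≡ false
  sgn-id = trans (⨁-cong (λ a → trans (⨁-cong (λ b →
             trans (cong (lt a b ∧_) (xor-same (lt a b))) (∧-zeroʳ (lt a b)))) (⨁-false N)))
           (⨁-false N)

  -- Counting the inversions of σ relative to any other injective relabelling u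
  -- of the positions gives the same parity: the two counts differ by the sum of
  -- the symmetric, zero-diagonal matrix Δ u id ∧ Δ id σ.
  sgn-relative : ∀ {σ u} → Injective σ → Injective u →
                 ⨁ (λ x → ⨁ (λ y → lt (u x) (u y) ∧ Δ id σ x y)) ≡ sgn σ
  sgn-relative {σ} {u} σ-inj u-inj = xor≡false⇒≡ _ _ (begin
      ⨁ (λ x → ⨁ (λ y → lt (u x) (u y) ∧ Δ id σ x y)) xor sgn σ
    ≡⟨ sym (⊕.∑-distrib-+ (λ x → ⨁ (λ y → lt (u x) (u y) ∧ Δ id σ x y)) (λ x → ⨁ (λ y → lt x y ∧ Δ id σ x y))) ⟩
      ⨁ (λ x → ⨁ (λ y → lt (u x) (u y) ∧ Δ id σ x y) xor ⨁ (λ y → lt x y ∧ Δ id σ x y))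
    ≡⟨ ⨁-cong (λ x → sym (⊕.∑-distrib-+ (λ y → lt (u x) (u y) ∧ Δ id σ x y) (λ y → lt x y ∧ Δ id σ x y))) ⟩
      ⨁ (λ x → ⨁ (λ y → (lt (u x) (u y) ∧ Δ id σ x y) xor (lt x y ∧ Δ id σ x y)))
    ≡⟨ ⨁-cong (λ x → ⨁-cong (λ y → sym (∧-distribʳ-xor (Δ id σ x y) (lt (u x) (u y)) (lt x y)))) ⟩
      ⨁ (λ x → ⨁ (K x))
    ≡⟨ ⨁⨁-symmetric K K-symmetric (λ x → cong (_∧ Δ id σ x x) (Δ-diagonal u id x)) ⟩
      false
    ∎)
    where
      open ≡-Reasoning
      K : Fin N → Fin N → Bool
      K x y = Δ u id x y ∧ Δ id σ x y
      K-symmetric : ∀ x y → K x y ≡ K y x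
      K-symmetric x y = cong₂ _∧_ (Δ-symmetric u-inj id x y) (Δ-symmetric id σ-inj x y)

  sgn-∘ : ∀ {σ} → Injective σ → (τ : Permutation′ N) →
          sgn (σ ∘ (τ ⟨$⟩ʳ_)) ≡ sgn σ xor sgn (τ ⟨$⟩ʳ_)
  sgn-∘ {σ} σ-inj τ = begin
      sgn (σ ∘ t)
    ≡⟨ ⨁-cong (λ a → ⨁-cong (λ b → split a b)) ⟩
      ⨁ (λ a → ⨁ (λ b → (lt a b ∧ Δ id t a b) xor G (t a) (t b)))
    ≡⟨ ⨁-cong (λ a → ⊕.∑-distrib-+ (λ b → lt a b ∧ Δ id t a b) (λ b → G (t a) (t b))) ⟩
      ⨁ (λ a → ⨁ (λ b → lt a b ∧ Δ id t a b) xor ⨁ (λ b → G (t a) (t b)))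
    ≡⟨ ⊕.∑-distrib-+ (λ a → ⨁ (λ b → lt a b ∧ Δ id t a b)) (λ a → ⨁ (λ b → G (t a) (t b))) ⟩
      sgn t xor ⨁ (λ a → ⨁ (λ b → G (t a) (t b)))
    ≡⟨ cong (sgn t xor_) reindex ⟩
      sgn t xor ⨁ (λ x → ⨁ (G x))
    ≡⟨ cong (sgn t xor_) (sgn-relative σ-inj u-inj) ⟩
      sgn t xor sgn σ
    ≡⟨ xor-comm (sgn t) (sgn σ) ⟩
      sgn σ xor sgn t
    ∎
    where
      open ≡-Reasoning
      t u : Fin N → Fin N
      t = τ ⟨$⟩ʳ_
      u = τ ⟨$⟩ˡ_
      u-inj : Injective u
      u-inj {x} {y} e = trans (sym (FinPerm.inverseʳ τ)) (trans (cong t e) (FinPerm.inverseʳ τ))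
      -- inversions of σ ∘ t, counted in the order given by the inverse of t
      G : Fin N → Fin N → Bool
      G x y = lt (u x) (u y) ∧ Δ id σ x y
      split : ∀ a b → lt a b ∧ Δ id (σ ∘ t) a b ≡ (lt a b ∧ Δ id t a b) xor G (t a) (t b)
      split a b = begin
          lt a b ∧ Δ id (σ ∘ t) a b
        ≡⟨ cong (lt a b ∧_) (sym (xor-telescope (lt a b) (lt (t a) (t b)) _)) ⟩
          lt a b ∧ (Δ id t a b xor Δ id σ (t a) (t b))
        ≡⟨ ∧-distribˡ-xor (lt a b) _ _ ⟩
          (lt a b ∧ Δ id t a b) xor (lt a b ∧ Δ id σ (t a) (t b))
        ≡⟨ cong₂ (λ p q → (lt a b ∧ Δ id t a b) xor (lt p q ∧ Δ id σ (t a) (t b)))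
                 (sym (FinPerm.inverseˡ τ)) (sym (FinPerm.inverseˡ τ)) ⟩
          (lt a b ∧ Δ id t a b) xor G (t a) (t b)
        ∎
      reindex : ⨁ (λ a → ⨁ (λ b → G (t a) (t b))) ≡ ⨁ (λ x → ⨁ (G x))
      reindex = trans (⨁-cong (λ a → sym (⊕.sum-permute (G (t a)) τ)))
                      (sym (⊕.sum-permute (λ x → ⨁ (G x)) τ))

  sgn-inverse : (τ : Permutation′ N) → sgn (τ ⟨$⟩ˡ_) ≡ sgn (τ ⟨$⟩ʳ_)
  sgn-inverse τ = sym (xor≡false⇒≡ _ _ (begin
      sgn (τ ⟨$⟩ʳ_) xor sgn (τ ⟨$⟩ˡ_)
    ≡⟨ sym (sgn-∘ t-inj (FinPerm.flip τ)) ⟩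
      sgn ((τ ⟨$⟩ʳ_) ∘ (τ ⟨$⟩ˡ_))
    ≡⟨ sgn-cong (λ _ → FinPerm.inverseʳ τ) ⟩
      sgn id
    ≡⟨ sgn-id ⟩
      false
    ∎))
    where
      open ≡-Reasoning
      t-inj : Injective (τ ⟨$⟩ʳ_)
      t-inj e = trans (sym (FinPerm.inverseˡ τ)) (trans (cong (τ ⟨$⟩ˡ_) e) (FinPerm.inverseˡ τ))

module Transposition {X : Set} (_≟X_ : DecidableEquality X) where

  swap : X → X → X → X
  swap a b x with x ≟X a
  ... | yes _ = b
  ... | no _ with x ≟X b
  ...   | yes _ = a
  ...   | no _  = x

  swap-left : ∀ a b → swap a b a ≡ b
  swap-left a b with a ≟X a
  ... | yes _   = refl
  ... | no a≢a  = ⊥-elim (a≢a refl)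

  swap-right : ∀ a b → swap a b b ≡ a
  swap-right a b with b ≟X a
  ... | yes b≡a = b≡a
  ... | no _ with b ≟X b
  ...   | yes _  = refl
  ...   | no b≢b = ⊥-elim (b≢b refl)

  swap-other : ∀ a b x → ¬ x ≡ a → ¬ x ≡ b → swap a b x ≡ x
  swap-other a b x x≢a x≢b with x ≟X a
  ... | yes x≡a = ⊥-elim (x≢a x≡a)
  ... | no _ with x ≟X b
  ...   | yes x≡b = ⊥-elim (x≢b x≡b)
  ...   | no _    = refl

  swap-involutive : ∀ a b x → swap a b (swap a b x) ≡ x
  swap-involutive a b x with x ≟X a
  ... | yes refl = swap-right x b
  ... | no x≢a with x ≟X b
  ...   | yes refl = swap-left a x
  ...   | no x≢b   = swap-other a b x x≢a x≢b

  swap-injective : ∀ a b → Injective (swap a b)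
  swap-injective a b {x} {y} e =
    trans (sym (swap-involutive a b x)) (trans (cong (swap a b) e) (swap-involutive a b y))

swap-natural : ∀ {X Y : Set} (_≟X_ : DecidableEquality X) (_≟Y_ : DecidableEquality Y)
               {f : X → Y} → Injective f → ∀ a b x →
               f (Transposition.swap _≟X_ a b x) ≡ Transposition.swap _≟Y_ (f a) (f b) (f x)
swap-natural _≟X_ _≟Y_ {f} f-inj a b x with x ≟X a
... | yes refl = sym (SY.swap-left (f x) (f b))
  where module SY = Transposition _≟Y_
... | no x≢a with x ≟X b
...   | yes refl = sym (SY.swap-right (f a) (f x))
  where module SY = Transposition _≟Y_
...   | no x≢b = sym (SY.swap-other (f a) (f b) (f x) (x≢a ∘ f-inj) (x≢b ∘ f-inj))
  where module SY = Transposition _≟Y_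

module _ {N : ℕ} where
  open Transposition (_≟_ {N})

  swapₚ : Fin N → Fin N → Permutation′ N
  swapₚ a b = permutation (swap a b) (swap a b) (swap-involutive a b) (swap-involutive a b)

sgn-swap₀₁ : ∀ {k} → sgn (Transposition.swap (_≟_ {suc (suc k)}) zero (suc zero)) ≡ true
sgn-swap₀₁ {k} = begin
    sgn s
  ≡⟨⟩
    (true xor ⨁ (λ b → inv 0F (suc (suc b)))) xor
      (⨁ (λ b → inv 1F (suc (suc b))) xor ⨁ (λ a → ⨁ (λ b → inv (suc (suc a)) (suc (suc b)))))
  ≡⟨ cong₂ (λ p q → (true xor p) xor q) (⨁-false k) (cong₂ _xor_ (⨁-false k) rest-even) ⟩
    true
  ∎
  where
    open ≡-Reasoning
    0F 1F : Fin (suc (suc k))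
    0F = zero
    1F = suc zero
    s : Fin (suc (suc k)) → Fin (suc (suc k))
    s = Transposition.swap _≟_ 0F 1F
    inv : Fin (suc (suc k)) → Fin (suc (suc k)) → Bool
    inv a b = lt a b ∧ Δ id s a b
    no-inversion : ∀ l → l ∧ (l xor l) ≡ false
    no-inversion false = refl
    no-inversion true  = refl
    -- s fixes the points 2, 3, ..., so they contribute no inversions.
    rest-even : ⨁ (λ a → ⨁ (λ b → inv (suc (suc a)) (suc (suc b)))) ≡ false
    rest-even = trans (⨁-cong (λ a → trans (⨁-cong (λ b → no-inversion (lt (suc₂ a) (suc₂ b)))) (⨁-false k)))
                      (⨁-false k)
      where
        suc₂ : Fin k → Fin (suc (suc k))
        suc₂ i = suc (suc i)

-- Every transposition of two distinct points is odd, being conjugate to swap₀₁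
-- by π = swap 0 a ∘ swap 1 c, which sends 0 to a and 1 to b.
sgn-swap : ∀ {N} (a b : Fin N) → ¬ a ≡ b → sgn (Transposition.swap _≟_ a b) ≡ true
sgn-swap {suc zero}    zero zero a≢b = ⊥-elim (a≢b refl)
sgn-swap {suc (suc k)} a    b    a≢b = begin
    sgn (swap a b)
  ≡⟨ sgn-cong conjugate ⟩
    sgn (π ∘ (swap 0F 1F ∘ π⁻¹))
  ≡⟨ sgn-∘ π-injective (π⁻¹ₚ ∘ₚ swapₚ 0F 1F) ⟩
    sgn π xor sgn (swap 0F 1F ∘ π⁻¹)
  ≡⟨ cong (sgn π xor_) (sgn-∘ (swap-injective 0F 1F) π⁻¹ₚ) ⟩
    sgn π xor (sgn (swap 0F 1F) xor sgn π⁻¹)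
  ≡⟨ cong₂ (λ p q → sgn π xor (p xor q)) (sgn-swap₀₁ {k}) (sym (sgn-inverse π⁻¹ₚ)) ⟩
    sgn π xor (true xor sgn π)
  ≡⟨ trans (cong (sgn π xor_) (xor-comm true (sgn π))) (xor-cancelˡ (sgn π) true) ⟩
    true
  ∎
  where
    open ≡-Reasoning
    open Transposition (_≟_ {suc (suc k)})
    0F 1F c : Fin (suc (suc k))
    0F = zero
    1F = suc zero
    c  = swap 0F a b
    π⁻¹ₚ : Permutation′ (suc (suc k))
    π⁻¹ₚ = swapₚ 0F a ∘ₚ swapₚ 1F c
    π π⁻¹ : Fin (suc (suc k)) → Fin (suc (suc k))
    π   = π⁻¹ₚ ⟨$⟩ˡ_
    π⁻¹ = π⁻¹ₚ ⟨$⟩ʳ_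
    π-injective : Injective π
    π-injective = swap-injective 1F c ∘ swap-injective 0F a
    c≢0 : ¬ c ≡ 0F
    c≢0 c≡0 = a≢b (trans (sym (swap-left 0F a)) (trans (cong (swap 0F a) (sym c≡0)) (swap-involutive 0F a b)))
    π-0 : π 0F ≡ a
    π-0 = trans (cong (swap 0F a) (swap-other 1F c 0F (λ ()) (c≢0 ∘ sym))) (swap-left 0F a)
    π-1 : π 1F ≡ b
    π-1 = trans (cong (swap 0F a) (swap-left 1F c)) (swap-involutive 0F a b)
    conjugate : ∀ x → swap a b x ≡ π (swap 0F 1F (π⁻¹ x))
    conjugate x = begin
        swap a b x
      ≡⟨ cong₂ (λ p q → swap p q x) (sym π-0) (sym π-1) ⟩
        swap (π 0F) (π 1F) x
      ≡⟨ cong (swap (π 0F) (π 1F)) (sym (FinPerm.inverseˡ π⁻¹ₚ {x})) ⟩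
        swap (π 0F) (π 1F) (π (π⁻¹ x))
      ≡⟨ sym (swap-natural _≟_ _≟_ π-injective 0F 1F (π⁻¹ x)) ⟩
        π (swap 0F 1F (π⁻¹ x))
      ∎

record Perm (X : Set) : Set where
  field
    to from : X → X
    to-from : ∀ x → to (from x) ≡ x
    from-to : ∀ x → from (to x) ≡ x
open Perm public

module _ {X : Set} where

  idₚ : Perm X
  idₚ = record { to = id ; from = id ; to-from = λ _ → refl ; from-to = λ _ → refl }

  _⊙_ : Perm X → Perm X → Perm X
  p ⊙ q = record
    { to = to p ∘ to q ; from = from q ∘ from p
    ; to-from = λ x → trans (cong (to p) (to-from q (from p x))) (to-from p x)
    ; from-to = λ x → trans (cong (from q) (from-to p (to q x))) (from-to q x) }

  inverse : Perm X → Perm X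
  inverse p = record { to = from p ; from = to p ; to-from = from-to p ; from-to = to-from p }

  _^_ : Perm X → Sign → Perm X
  p ^ Sg.+ = p
  p ^ Sg.- = inverse p

  to-injective : (p : Perm X) → Injective (to p)
  to-injective p {x} {y} e = trans (sym (from-to p x)) (trans (cong (from p) e) (from-to p y))

  ^-fixes : ∀ (p : Perm X) s {x} → to p x ≡ x → to (p ^ s) x ≡ x
  ^-fixes p Sg.+ fx = fx
  ^-fixes p Sg.- {x} fx = trans (cong (from p) (sym fx)) (from-to p x)

  fixing-complement-preserves : (Q : X → Set) → (∀ x → Dec (Q x)) → (p : Perm X) →
                                (∀ x → ¬ Q x → to p x ≡ x) → ∀ x → Q x → Q (to p x)
  fixing-complement-preserves Q Q? p fixes x qx with Q? (to p x)
  ... | yes q  = q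
  ... | no ¬q = ⊥-elim (¬q (subst Q (sym (to-injective p (fixes (to p x) ¬q))) qx))

  ⨀ : ∀ {k} → (Fin k → Perm X) → Perm X
  ⨀ {zero}  g = idₚ
  ⨀ {suc k} g = g zero ⊙ ⨀ (g ∘ suc)

  ⨀-fixes : ∀ {k} (g : Fin k → Perm X) x → (∀ i → to (g i) x ≡ x) → to (⨀ g) x ≡ x
  ⨀-fixes {zero}  g x fx = refl
  ⨀-fixes {suc k} g x fx = trans (cong (to (g zero)) (⨀-fixes (g ∘ suc) x (fx ∘ suc))) (fx zero)

  -- On a set Q that is fixed pointwise by every factor but g i, and preserved by
  -- g i, the product acts as g i.  (Factors with disjoint supports commute.)
  ⨀-acts-as : ∀ {k} (g : Fin k → Perm X) (Q : X → Set) (i : Fin k) →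
              (∀ j → ¬ j ≡ i → ∀ x → Q x → to (g j) x ≡ x) →
              (∀ x → Q x → Q (to (g i) x)) →
              ∀ x → Q x → to (⨀ g) x ≡ to (g i) x
  ⨀-acts-as {suc k} g Q zero    others preserves x qx =
    cong (to (g zero)) (⨀-fixes (g ∘ suc) x (λ j → others (suc j) (λ ()) x qx))
  ⨀-acts-as {suc k} g Q (suc i) others preserves x qx =
    trans (cong (to (g zero))
                (⨀-acts-as (g ∘ suc) Q i (λ j j≢i → others (suc j) (j≢i ∘ suc-injective)) preserves x qx))
          (others zero (λ ()) _ (preserves x qx))

module _ {X : Set} where

  data Adjacent : List X → X → X → Set where
    adjacent-here  : ∀ {a b l} → Adjacent (a ∷ b ∷ l) a b
    adjacent-there : ∀ {c l a b} → Adjacent l a b → Adjacent (c ∷ l) a b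

  data Last : List X → X → Set where
    last-here  : ∀ {a} → Last (a ∷ []) a
    last-there : ∀ {c l a} → Last l a → Last (c ∷ l) a

  CyclicallyFollows : List X → X → X → Set
  CyclicallyFollows L a b = Adjacent L a b ⊎ (Last L a × ∃[ r ] L ≡ b ∷ r)

  adjacent-∈ˡ : ∀ {L a b} → Adjacent L a b → a ∈ₗ L
  adjacent-∈ˡ adjacent-here       = here refl
  adjacent-∈ˡ (adjacent-there ad) = there (adjacent-∈ˡ ad)

  adjacent-∈ʳ : ∀ {L a b} → Adjacent L a b → b ∈ₗ L
  adjacent-∈ʳ adjacent-here       = there (here refl)
  adjacent-∈ʳ (adjacent-there ad) = there (adjacent-∈ʳ ad)

  last-∈ : ∀ {L a} → Last L a → a ∈ₗ L
  last-∈ last-here      = here refl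
  last-∈ (last-there l) = there (last-∈ l)

  follows-∈ˡ : ∀ {L a b} → CyclicallyFollows L a b → a ∈ₗ L
  follows-∈ˡ (inj₁ ad)      = adjacent-∈ˡ ad
  follows-∈ˡ (inj₂ (la , _)) = last-∈ la

  adjacent-or-last : ∀ {L a} → a ∈ₗ L → (∃[ b ] Adjacent L a b) ⊎ Last L a
  adjacent-or-last {_ ∷ []}    (here refl) = inj₂ last-here
  adjacent-or-last {_ ∷ d ∷ _} (here refl) = inj₁ (d , adjacent-here)
  adjacent-or-last {_ ∷ _ ∷ _} (there a∈) with adjacent-or-last a∈
  ... | inj₁ (b , ad) = inj₁ (b , adjacent-there ad)
  ... | inj₂ la       = inj₂ (last-there la)

  follower : ∀ {L a} → a ∈ₗ L → ∃[ b ] CyclicallyFollows L a b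
  follower {c ∷ r} a∈ with adjacent-or-last a∈
  ... | inj₁ (b , ad) = b , inj₁ ad
  ... | inj₂ la       = c , inj₂ (la , r , refl)

module _ {X Y : Set} (f : X → Y) where

  map-follows : ∀ {L a b} → CyclicallyFollows L a b → CyclicallyFollows (map f L) (f a) (f b)
  map-follows (inj₁ ad)             = inj₁ (map-adjacent ad)
    where
      map-adjacent : ∀ {L a b} → Adjacent L a b → Adjacent (map f L) (f a) (f b)
      map-adjacent adjacent-here       = adjacent-here
      map-adjacent (adjacent-there ad) = adjacent-there (map-adjacent ad)
  map-follows (inj₂ (la , r , refl)) = inj₂ (map-last la , map f r , refl)
    where
      map-last : ∀ {L a} → Last L a → Last (map f L) (f a)
      map-last last-here      = last-here
      map-last (last-there l) = last-there (map-last l)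

least : (P : ℕ → Set) → (∀ k → Dec (P k)) → ∀ k → P k → ∃[ p ] (P p × (∀ q → q < p → ¬ P q))
least P P? zero    P0 = zero , P0 , λ _ ()
least P P? (suc k) Pk with P? zero
... | yes P0 = zero , P0 , λ _ ()
... | no ¬P0 with least (P ∘ suc) (P? ∘ suc) k Pk
...   | p , Pp , below = suc p , Pp , λ { zero _ → ¬P0 ; (suc q) (s≤s q<p) → below q q<p }

applyUpTo-adjacent : ∀ {X : Set} (g : ℕ → X) r n → suc r < n → Adjacent (applyUpTo g n) (g r) (g (suc r))
applyUpTo-adjacent g zero    (suc zero)    (s≤s ())
applyUpTo-adjacent g zero    (suc (suc n)) _             = adjacent-here
applyUpTo-adjacent g (suc r) (suc n)       (s≤s r+1<n) = adjacent-there (applyUpTo-adjacent (g ∘ suc) r n r+1<n)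

applyUpTo-last : ∀ {X : Set} (g : ℕ → X) n → Last (applyUpTo g (suc n)) (g n)
applyUpTo-last g zero    = last-here
applyUpTo-last g (suc n) = last-there (applyUpTo-last (g ∘ suc) n)

module Iterates {X : Set} (f : X → X) where

  infix 8 f^_
  f^_ : ℕ → X → X
  (f^ t) x = iterate f x t

  f^-+ : ∀ u t x → (f^ (u + t)) x ≡ (f^ t) ((f^ u) x)
  f^-+ zero    t x = refl
  f^-+ (suc u) t x = f^-+ u t (f x)

  f^-suc : ∀ t x → (f^ suc t) x ≡ f ((f^ t) x)
  f^-suc zero    x = refl
  f^-suc (suc t) x = f^-suc t (f x)

  f^-injective : Injective f → ∀ t → Injective (f^ t)
  f^-injective f-inj zero    e = e
  f^-injective f-inj (suc t) e = f-inj (f^-injective f-inj t e)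

  f^-preserves : (Q : X → Set) → (∀ x → Q x → Q (f x)) → ∀ t x → Q x → Q ((f^ t) x)
  f^-preserves Q pres zero    x qx = qx
  f^-preserves Q pres (suc t) x qx = f^-preserves Q pres t (f x) (pres x qx)

  -- A point of period p + 1 is fixed by f^(d (p + 1)), hence f^t x depends on t mod (p + 1).
  f^-period : ∀ p x → (f^ suc p) x ≡ x → ∀ t → (f^ t) x ≡ (f^ (t % suc p)) x
  f^-period p x per t = begin
      (f^ t) x
    ≡⟨ cong (λ u → (f^ u) x) (trans (m≡m%n+[m/n]*n t (suc p)) (ℕP.+-comm (t % suc p) _)) ⟩
      (f^ ((t / suc p) * suc p + t % suc p)) x
    ≡⟨ f^-+ ((t / suc p) * suc p) (t % suc p) x ⟩
      (f^ (t % suc p)) ((f^ ((t / suc p) * suc p)) x)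
    ≡⟨ cong (f^ (t % suc p)) (multiple (t / suc p)) ⟩
      (f^ (t % suc p)) x
    ∎
    where
      open ≡-Reasoning
      multiple : ∀ d → (f^ (d * suc p)) x ≡ x
      multiple zero    = refl
      multiple (suc d) = trans (f^-+ (suc p) (d * suc p) x) (trans (cong (f^ (d * suc p)) per) (multiple d))

-- The orbit of a periodic point x of an injective map f, listed as
-- x, f x, ..., f^p x where p + 1 is the least period.
module Orbit {X : Set} (f : X → X) (f-inj : Injective f) (_≟X_ : DecidableEquality X)
             (x : X) (t₀ : ℕ) (periodic : iterate f x (suc t₀) ≡ x) where
  open Iterates f

  private
    least-period : ∃[ p ] ((f^ suc p) x ≡ x × (∀ q → q < p → ¬ (f^ suc q) x ≡ x))
    least-period = least (λ q → (f^ suc q) x ≡ x) (λ q → (f^ suc q) x ≟X x) t₀ periodic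

  p : ℕ
  p = proj₁ least-period

  period : (f^ suc p) x ≡ x
  period = proj₁ (proj₂ least-period)

  minimal : ∀ q → q < p → ¬ (f^ suc q) x ≡ x
  minimal = proj₂ (proj₂ least-period)

  orbit : List X
  orbit = applyUpTo (λ t → (f^ t) x) (suc p)

  -- Iterates below the least period are distinct: f^a x ≡ f^b x with a < b would
  -- make f^(b - a) x ≡ x, with 0 < b - a < p + 1.
  orbit-unique : Unique orbit
  orbit-unique = applyUpTo⁺₁ (λ t → (f^ t) x) (suc p) distinct
    where
      distinct : ∀ {a b} → a < b → b < suc p → ¬ (f^ a) x ≡ (f^ b) x
      distinct {a} {suc c} (s≤s a≤c) (s≤s c<p) e =
        minimal (c ∸ a) (ℕP.≤-<-trans (ℕP.m∸n≤m c a) c<p) (f^-injective f-inj a (begin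
            (f^ a) ((f^ suc (c ∸ a)) x)
          ≡⟨ sym (f^-+ (suc (c ∸ a)) a x) ⟩
            (f^ (suc (c ∸ a) + a)) x
          ≡⟨ cong (λ u → (f^ suc u) x) (ℕP.m∸n+n≡m a≤c) ⟩
            (f^ suc c) x
          ≡⟨ sym e ⟩
            (f^ a) x
          ∎))
        where open ≡-Reasoning

  orbit-∈ : ∀ {z} → z ∈ₗ orbit → ∃[ t ] (f^ t) x ≡ z
  orbit-∈ z∈ with ∈-applyUpTo⁻ (λ t → (f^ t) x) z∈
  ... | t , _ , refl = t , refl

  orbit-follows : ∀ t → CyclicallyFollows orbit ((f^ t) x) (f ((f^ t) x))
  orbit-follows t = subst (λ z → CyclicallyFollows orbit z (f z)) (sym (f^-period p x period t))
                          (follows (t % suc p) (m%n<n t (suc p)))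
    where
      follows : ∀ r → r < suc p → CyclicallyFollows orbit ((f^ r) x) (f ((f^ r) x))
      follows r (s≤s r≤p) with ℕP.m≤n⇒m<n∨m≡n r≤p
      ... | inj₁ r<p  = inj₁ (subst (Adjacent orbit ((f^ r) x)) (f^-suc r x)
                                    (applyUpTo-adjacent (λ t → (f^ t) x) r (suc p) (s≤s r<p)))
      ... | inj₂ refl =
        inj₂ (applyUpTo-last (λ t → (f^ t) x) p , rest , cong (_∷ rest) (trans (sym period) (f^-suc p x)))
        where rest = applyUpTo (λ t → (f^ suc t) x) p

module _ {s : ℕ} where

  positions : (Fin s → Bool) → List (Fin s)
  positions P = filter (λ j → P j ≟ᵇ true) (allFin s)

  positions-∈⁺ : ∀ (P : Fin s → Bool) {j} → P j ≡ true → j ∈ₗ positions P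
  positions-∈⁺ P Pj = ∈-filter⁺ (λ j → P j ≟ᵇ true) (∈-allFin _) Pj

  positions-∈⁻ : ∀ (P : Fin s → Bool) {j} → j ∈ₗ positions P → P j ≡ true
  positions-∈⁻ P j∈ = proj₂ (∈-filter⁻ (λ j → P j ≟ᵇ true) {xs = allFin s} j∈)

  Sorted : List (Fin s) → Set
  Sorted = AllPairs (λ a b → toℕ a < toℕ b)

  positions-sorted : ∀ P → Sorted (positions P)
  positions-sorted P = AllPairsₚ.filter⁺ (λ j → P j ≟ᵇ true) (AllPairsₚ.tabulate⁺-< id)

  sorted⇒unique : ∀ {L} → Sorted L → Unique L
  sorted⇒unique = AllPairs.map (λ a<b a≡b → ℕP.<-irrefl (cong toℕ a≡b) a<b)

  adjacent-sorted : ∀ {L : List (Fin s)} {a b} → Sorted L → Adjacent L a b →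
                    toℕ a < toℕ b × (∀ {c} → c ∈ₗ L → toℕ c ≤ toℕ a ⊎ toℕ b ≤ toℕ c)
  adjacent-sorted ((a<b ∷ a<rest) ∷ (b<rest ∷ _)) adjacent-here = a<b , gap
    where
      gap : ∀ {c} → c ∈ₗ _ → _
      gap (here refl)         = inj₁ ℕP.≤-refl
      gap (there (here refl)) = inj₂ ℕP.≤-refl
      gap (there (there c∈))  = inj₂ (ℕP.<⇒≤ (All.lookup b<rest c∈))
  adjacent-sorted (x<rest ∷ sorted) (adjacent-there ad) with adjacent-sorted sorted ad
  ... | a<b , gap = a<b , gap′
    where
      gap′ : ∀ {c} → c ∈ₗ _ → _
      gap′ (here refl) = inj₁ (ℕP.<⇒≤ (All.lookup x<rest (adjacent-∈ˡ ad)))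
      gap′ (there c∈)  = gap c∈

  last-maximal : ∀ {L : List (Fin s)} {a} → Sorted L → Last L a → ∀ {c} → c ∈ₗ L → toℕ c ≤ toℕ a
  last-maximal _                 last-here       (here refl) = ℕP.≤-refl
  last-maximal (x<rest ∷ _)      (last-there la) (here refl) = ℕP.<⇒≤ (All.lookup x<rest (last-∈ la))
  last-maximal (_ ∷ sorted)      (last-there la) (there c∈)  = last-maximal sorted la c∈

  head-minimal : ∀ {b : Fin s} {r} → Sorted (b ∷ r) → ∀ {c} → c ∈ₗ b ∷ r → toℕ b ≤ toℕ c
  head-minimal _              (here refl) = ℕP.≤-refl
  head-minimal (b<rest ∷ _)   (there c∈)  = ℕP.<⇒≤ (All.lookup b<rest c∈)

length-filter-tabulate : ∀ {A : Set} {s} (g : Fin s → A) (h : A → Bool) →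
  length (filter (λ a → h a ≟ᵇ true) (tabulate g)) ≡ ∑ (λ j → if h (g j) then 1 else 0)
length-filter-tabulate {s = zero}  g h = refl
length-filter-tabulate {s = suc s} g h with h (g Fin.zero)
... | true  = cong suc (length-filter-tabulate (g ∘ Fin.suc) h)
... | false = length-filter-tabulate (g ∘ Fin.suc) h

length-positions : ∀ {s} (P : Fin s → Bool) → length (positions P) ≡ ∑ (λ j → if P j then 1 else 0)
length-positions P = length-filter-tabulate id P

-- NextOn P j j': j' is the first point after j, going cyclically around Fin s,
-- at which P holds.  This is the row (column) successor of the array, read on a
-- single row (column).
NextOn : ∀ {s} → (Fin s → Bool) → Fin s → Fin s → Set
NextOn P j j' = P j ≡ true × P j' ≡ true ×
  ∃[ k ] (1 ≤ k × ShiftMod j k j' × (∀ k' j'' → 1 ≤ k' → k' < k → ShiftMod j k' j'' → ¬ (P j'' ≡ true)))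

shift-unique : ∀ {s} {a b b′ : Fin s} {k} → ShiftMod a k b → ShiftMod a k b′ → b ≡ b′
shift-unique {suc s} {a} {b} {b′} {k} (q , e) (q′ , e′) = toℕ-injective (begin
    toℕ b                         ≡⟨ sym (m<n⇒m%n≡m (toℕ<n b)) ⟩
    toℕ b % suc s                 ≡⟨ sym ([m+kn]%n≡m%n (toℕ b) q (suc s)) ⟩
    (toℕ b + q * suc s) % suc s   ≡⟨ cong (_% suc s) (trans (sym e) e′) ⟩
    (toℕ b′ + q′ * suc s) % suc s ≡⟨ [m+kn]%n≡m%n (toℕ b′) q′ (suc s) ⟩
    toℕ b′ % suc s                ≡⟨ m<n⇒m%n≡m (toℕ<n b′) ⟩
    toℕ b′                        ∎)
  where open ≡-Reasoning

-- The next point is unique: of two candidates, the farther one would violate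
-- the minimality of the nearer.
next-unique : ∀ {s} (P : Fin s → Bool) {j a b} → NextOn P j a → NextOn P j b → a ≡ b
next-unique P {j} (_ , Pa , ka , 1≤ka , sa , before-a) (_ , Pb , kb , 1≤kb , sb , before-b)
  with ℕP.<-cmp ka kb
... | tri< ka<kb _ _ = ⊥-elim (before-b ka _ 1≤ka ka<kb sa Pa)
... | tri> _ _ kb<ka = ⊥-elim (before-a kb _ 1≤kb kb<ka sb Pb)
... | tri≈ _ refl _ = shift-unique {a = j} {k = ka} sa sb

shift-cases : ∀ {s} {a c : Fin s} {k} q → toℕ a + k ≡ toℕ c + q * s →
              toℕ a + k ≡ toℕ c ⊎ s + toℕ c ≤ toℕ a + k
shift-cases zero e = inj₁ (trans e (ℕP.+-identityʳ _))
shift-cases {s} {a} {c} (suc q) e = inj₂ (subst (s + toℕ c ≤_) (sym e)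
  (subst (_≤ toℕ c + (s + q * s)) (ℕP.+-comm (toℕ c) s) (ℕP.+-monoʳ-≤ (toℕ c) (ℕP.m≤m+n s (q * s)))))

module _ {s : ℕ} (P : Fin s → Bool) {a b : Fin s} (Pa : P a ≡ true) (Pb : P b ≡ true) where

  next-within : toℕ a < toℕ b → (∀ c → P c ≡ true → toℕ c ≤ toℕ a ⊎ toℕ b ≤ toℕ c) → NextOn P a b
  next-within a<b gap =
    Pa , Pb , k , ℕP.m<n⇒0<n∸m a<b , (0 , trans a+k≡b (sym (ℕP.+-identityʳ _))) , nothing-between
    where
      k = toℕ b ∸ toℕ a
      a+k≡b : toℕ a + k ≡ toℕ b
      a+k≡b = ℕP.m+[n∸m]≡n (ℕP.<⇒≤ a<b)
      a+k′<b : ∀ {k′} → k′ < k → toℕ a + k′ < toℕ b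
      a+k′<b k′<k = subst (toℕ a + _ <_) a+k≡b (ℕP.+-monoʳ-< (toℕ a) k′<k)
      nothing-between : ∀ k′ c → 1 ≤ k′ → k′ < k → ShiftMod a k′ c → ¬ (P c ≡ true)
      nothing-between k′ c 1≤k′ k′<k (q , e) Pc with shift-cases {a = a} {c = c} q e | gap c Pc
      ... | inj₁ a+k′≡c | inj₁ c≤a =
        ℕP.<-irrefl refl (ℕP.<-≤-trans (subst (toℕ a <_) a+k′≡c (ℕP.m<m+n (toℕ a) 1≤k′)) c≤a)
      ... | inj₁ a+k′≡c | inj₂ b≤c = ℕP.<-irrefl a+k′≡c (ℕP.<-≤-trans (a+k′<b k′<k) b≤c)
      ... | inj₂ s+c≤   | _        =
        ℕP.<-irrefl refl (ℕP.≤-<-trans (ℕP.≤-trans (ℕP.m≤m+n s (toℕ c)) s+c≤) (ℕP.<-trans (a+k′<b k′<k) (toℕ<n b)))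

  next-around : (∀ c → P c ≡ true → toℕ b ≤ toℕ c × toℕ c ≤ toℕ a) → NextOn P a b
  next-around bounds =
    Pa , Pb , k , ℕP.≤-trans (ℕP.m<n⇒0<n∸m (toℕ<n a)) (ℕP.m≤m+n (s ∸ toℕ a) (toℕ b)) ,
    (1 , trans a+k≡s+b (trans (ℕP.+-comm s (toℕ b)) (cong (toℕ b +_) (sym (ℕP.+-identityʳ s))))) ,
    nothing-between
    where
      k = (s ∸ toℕ a) + toℕ b
      a+k≡s+b : toℕ a + k ≡ s + toℕ b
      a+k≡s+b = trans (sym (ℕP.+-assoc (toℕ a) (s ∸ toℕ a) (toℕ b)))
                      (cong (_+ toℕ b) (ℕP.m+[n∸m]≡n (ℕP.<⇒≤ (toℕ<n a))))
      nothing-between : ∀ k′ c → 1 ≤ k′ → k′ < k → ShiftMod a k′ c → ¬ (P c ≡ true)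
      nothing-between k′ c 1≤k′ k′<k (q , e) Pc with shift-cases {a = a} {c = c} q e
      ... | inj₁ a+k′≡c =
        ℕP.<-irrefl refl (ℕP.<-≤-trans (subst (toℕ a <_) a+k′≡c (ℕP.m<m+n (toℕ a) 1≤k′)) (proj₂ (bounds c Pc)))
      ... | inj₂ s+c≤ = ℕP.<-irrefl refl (ℕP.<-≤-trans
                          (ℕP.+-cancelˡ-< s (toℕ c) (toℕ b)
                            (ℕP.≤-<-trans s+c≤ (subst (toℕ a + k′ <_) a+k≡s+b (ℕP.+-monoʳ-< (toℕ a) k′<k))))
                          (proj₁ (bounds c Pc)))

follows⇒next : ∀ {s} (P : Fin s → Bool) {a b} → CyclicallyFollows (positions P) a b → NextOn P a b
follows⇒next P (inj₁ ad) with adjacent-sorted (positions-sorted P) ad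
... | a<b , gap = next-within P (positions-∈⁻ P (adjacent-∈ˡ ad)) (positions-∈⁻ P (adjacent-∈ʳ ad))
                              a<b (λ c Pc → gap (positions-∈⁺ P Pc))
follows⇒next P (inj₂ (la , r , eq)) =
  next-around P (positions-∈⁻ P (last-∈ la)) (positions-∈⁻ P (subst (_ ∈ₗ_) (sym eq) (here refl)))
    (λ c Pc → head-minimal (subst Sorted eq (positions-sorted P)) (subst (c ∈ₗ_) eq (positions-∈⁺ P Pc)) ,
              last-maximal (positions-sorted P) la (positions-∈⁺ P Pc))

step-target : ∀ {s} (P : Fin s → Bool) t {a b} → Pow± (NextOn P) t a b → P b ≡ true
step-target P Sg.+ next = proj₁ (proj₂ next)
step-target P Sg.- next = proj₁ next

length-concat-tabulate : ∀ {X : Set} {k} (g : Fin k → List X) → length (concat (tabulate g)) ≡ ∑ (length ∘ g)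
length-concat-tabulate {k = zero}  g = refl
length-concat-tabulate {k = suc k} g =
  trans (length-++ (g zero)) (cong (length (g zero) +_) (length-concat-tabulate (g ∘ suc)))

module FiniteSign {X : Set} (N : ℕ) (enc : X → Fin N) (dec : Fin N → X)
                  (dec-enc : ∀ x → dec (enc x) ≡ x) (enc-dec : ∀ i → enc (dec i) ≡ i) where

  enc-injective : Injective enc
  enc-injective {x} {y} e = trans (sym (dec-enc x)) (trans (cong dec e) (dec-enc y))

  _≟X_ : DecidableEquality X
  x ≟X y = map′ enc-injective (cong enc) (enc x ≟ enc y)

  code : Perm X → Permutation′ N
  code p = permutation (enc ∘ to p ∘ dec) (enc ∘ from p ∘ dec)
    (λ i → trans (cong (enc ∘ to p) (dec-enc _)) (trans (cong enc (to-from p _)) (enc-dec i)))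
    (λ i → trans (cong (enc ∘ from p) (dec-enc _)) (trans (cong enc (from-to p _)) (enc-dec i)))

  sign : Perm X → Bool
  sign p = sgn (code p ⟨$⟩ʳ_)

  sign-cong : (p q : Perm X) → (∀ x → to p x ≡ to q x) → sign p ≡ sign q
  sign-cong p q p≗q = sgn-cong (λ i → cong enc (p≗q (dec i)))

  sign-id : sign idₚ ≡ false
  sign-id = trans (sgn-cong enc-dec) (sgn-id {N})

  sign-⊙ : (p q : Perm X) → sign (p ⊙ q) ≡ sign p xor sign q
  sign-⊙ p q = trans (sgn-cong (λ i → cong (enc ∘ to p) (sym (dec-enc (to q (dec i))))))
                     (sgn-∘ code-p-injective (code q))
    where
      code-p-injective : Injective (code p ⟨$⟩ʳ_)
      code-p-injective {i} {j} e =
        trans (sym (enc-dec i)) (trans (cong enc (to-injective p (enc-injective e))) (enc-dec j))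

  sign-inverse : (p : Perm X) → sign (inverse p) ≡ sign p
  sign-inverse p = sgn-inverse (code p)

  sign-^ : (p : Perm X) → ∀ s → sign (p ^ s) ≡ sign p
  sign-^ p Sg.+ = refl
  sign-^ p Sg.- = sign-inverse p

  sign-⨀ : ∀ {k} (g : Fin k → Perm X) → sign (⨀ g) ≡ ⨁ (λ i → sign (g i))
  sign-⨀ {zero}  g = sign-id
  sign-⨀ {suc k} g = trans (sign-⊙ (g zero) (⨀ (g ∘ suc))) (cong (sign (g zero) xor_) (sign-⨀ (g ∘ suc)))

  open Transposition _≟X_ public

  transposition : X → X → Perm X
  transposition a b = record { to = swap a b ; from = swap a b
                             ; to-from = swap-involutive a b ; from-to = swap-involutive a b }

  sign-transposition : ∀ a b → ¬ a ≡ b → sign (transposition a b) ≡ true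
  sign-transposition a b a≢b =
    trans (sgn-cong (λ i → trans (swap-natural _≟X_ _≟_ enc-injective a b (dec i))
                                 (cong (Transposition.swap _≟_ (enc a) (enc b)) (enc-dec i))))
          (sgn-swap (enc a) (enc b) (a≢b ∘ enc-injective))

  cycle : List X → Perm X
  cycle []          = idₚ
  cycle (x ∷ [])    = idₚ
  cycle (x ∷ y ∷ r) = transposition x y ⊙ cycle (y ∷ r)

  sign-cycle : ∀ x r → Unique (x ∷ r) → sign (cycle (x ∷ r)) ≡ odd (length r)
  sign-cycle x []      _ = sign-id
  sign-cycle x (y ∷ r) ((x≢y ∷ _) ∷ u) =
    trans (sign-⊙ (transposition x y) (cycle (y ∷ r)))
          (cong₂ _xor_ (sign-transposition x y x≢y) (sign-cycle y r u))

  sign-nonempty-cycle : ∀ {L z} → Unique L → z ∈ₗ L → sign (cycle L) ≡ not (odd (length L))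
  sign-nonempty-cycle {x ∷ r} u _ = trans (sign-cycle x r u) (sym (not-involutive (odd (length r))))

  cycle-fixes : ∀ L a → a ∉ₗ L → to (cycle L) a ≡ a
  cycle-fixes []          a a∉ = refl
  cycle-fixes (x ∷ [])    a a∉ = refl
  cycle-fixes (x ∷ y ∷ r) a a∉ =
    trans (cong (swap x y) (cycle-fixes (y ∷ r) a (a∉ ∘ there)))
          (swap-other x y a (a∉ ∘ here) (a∉ ∘ there ∘ here))

  cycle-follows : ∀ L {a b} → Unique L → CyclicallyFollows L a b → to (cycle L) a ≡ b
  cycle-follows (x ∷ [])    u (inj₂ (last-here , _ , refl)) = refl
  cycle-follows (x ∷ y ∷ r) (x∉ ∷ u) (inj₁ adjacent-here) =
    trans (cong (swap x y) (cycle-fixes (y ∷ r) x (Unique[x∷xs]⇒x∉xs (x∉ ∷ u)))) (swap-left x y)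
  cycle-follows (x ∷ y ∷ r) (x∉ ∷ u) (inj₁ (adjacent-there ad)) =
    trans (cong (swap x y) (cycle-follows (y ∷ r) u (inj₁ ad)))
          (swap-other x y _ (λ { refl → Unique[x∷xs]⇒x∉xs (x∉ ∷ u) (adjacent-∈ʳ ad) })
                            (λ { refl → Unique[x∷xs]⇒x∉xs u (tail-∈ ad) }))
    where
      tail-∈ : ∀ {l a b} → Adjacent (y ∷ l) a b → b ∈ₗ l
      tail-∈ adjacent-here       = here refl
      tail-∈ (adjacent-there ad) = adjacent-∈ʳ ad
  cycle-follows (x ∷ y ∷ r) (_ ∷ u) (inj₂ (last-there la , _ , refl)) =
    trans (cong (swap x y) (cycle-follows (y ∷ r) u (inj₂ (la , r , refl)))) (swap-right x y)

  -- A family of k "lines" in X: line l consists of the points emb l a with P l a,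
  -- for a ∈ Fin s, each line being traversed cyclically in the direction dir l.
  -- Rows and columns of the array are the two instances.
  module Lines {k s : ℕ} (P : Fin k → Fin s → Bool) (emb : Fin k → Fin s → X)
               (lineOf : X → Fin k) (lineOf-emb : ∀ l a → lineOf (emb l a) ≡ l)
               (emb-injective : ∀ l → Injective (emb l)) (dir : Fin k → Sign) where

    cells : Fin k → List X
    cells l = map (emb l) (positions (P l))

    cells-∈⁺ : ∀ l {a} → P l a ≡ true → emb l a ∈ₗ cells l
    cells-∈⁺ l Pa = ∈-map⁺ (emb l) (positions-∈⁺ (P l) Pa)

    cells-∈⁻ : ∀ l {z} → z ∈ₗ cells l → ∃[ a ] (z ≡ emb l a × P l a ≡ true)
    cells-∈⁻ l z∈ with ∈-map⁻ (emb l) z∈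
    ... | a , a∈ , refl = a , refl , positions-∈⁻ (P l) a∈

    cells-line : ∀ l {z} → z ∈ₗ cells l → lineOf z ≡ l
    cells-line l z∈ with cells-∈⁻ l z∈
    ... | a , refl , _ = lineOf-emb l a

    cells-unique : ∀ l → Unique (cells l)
    cells-unique l = Uniqueₚ.map⁺ (emb-injective l) (sorted⇒unique (positions-sorted (P l)))

    next⇒cycle : ∀ l {a b} → NextOn (P l) a b → to (cycle (cells l)) (emb l a) ≡ emb l b
    next⇒cycle l next with follower (positions-∈⁺ (P l) (proj₁ next))
    ... | b , follows with next-unique (P l) next (follows⇒next (P l) follows)
    ... | refl = cycle-follows (cells l) (cells-unique l) (map-follows (emb l) follows)

    σ : Fin k → Perm X
    σ l = cycle (cells l) ^ dir l

    step⇒cycle : ∀ l s {a b} → Pow± (NextOn (P l)) s a b → emb l b ≡ to (cycle (cells l) ^ s) (emb l a)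
    step⇒cycle l Sg.+ next = sym (next⇒cycle l next)
    step⇒cycle l Sg.- {a} {b} next =
      trans (sym (from-to (cycle (cells l)) (emb l b))) (cong (from (cycle (cells l))) (next⇒cycle l next))

    σ-fixes : ∀ l z → z ∉ₗ cells l → to (σ l) z ≡ z
    σ-fixes l z z∉ = ^-fixes (cycle (cells l)) (dir l) (cycle-fixes (cells l) z z∉)

    perm : Perm X
    perm = ⨀ σ

    -- The lines are disjoint, so on each line perm acts as that line's cycle.
    perm-on-line : ∀ z → to perm z ≡ to (σ (lineOf z)) z
    perm-on-line z = ⨀-acts-as σ OnLine (lineOf z) others preserves z refl
      where
        OnLine : X → Set
        OnLine w = lineOf w ≡ lineOf z
        others : ∀ l → ¬ l ≡ lineOf z → ∀ w → OnLine w → to (σ l) w ≡ w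
        others l l≢ w w-on = σ-fixes l w (λ w∈ → l≢ (trans (sym (cells-line l w∈)) w-on))
        preserves : ∀ w → OnLine w → OnLine (to (σ (lineOf z)) w)
        preserves = fixing-complement-preserves OnLine (λ w → lineOf w ≟ lineOf z) (σ (lineOf z))
                      (λ w off → σ-fixes (lineOf z) w (off ∘ cells-line (lineOf z)))

    perm-fixes : ∀ z → (∀ l → z ∉ₗ cells l) → to perm z ≡ z
    perm-fixes z off = ⨀-fixes σ z (λ l → σ-fixes l z (off l))

    -- When every line is nonempty, line l is a c-cycle of sign c - 1, where c counts
    -- its cells; summing over the k lines gives k plus the total number of cells.
    sign-perm : (∀ l → ∃[ a ] P l a ≡ true) →
                sign perm ≡ odd k xor odd (∑ (λ l → ∑ (λ a → if P l a then 1 else 0)))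
    sign-perm nonempty = begin
        sign (⨀ σ)
      ≡⟨ sign-⨀ σ ⟩
        ⨁ (λ l → sign (σ l))
      ≡⟨ ⨁-cong sign-σ ⟩
        ⨁ (λ l → not (odd (∑ (λ a → if P l a then 1 else 0))))
      ≡⟨ ⨁-even (λ l → ∑ (λ a → if P l a then 1 else 0)) ⟩
        odd k xor odd (∑ (λ l → ∑ (λ a → if P l a then 1 else 0)))
      ∎
      where
        open ≡-Reasoning
        sign-σ : ∀ l → sign (σ l) ≡ not (odd (∑ (λ a → if P l a then 1 else 0)))
        sign-σ l = trans (sign-^ (cycle (cells l)) (dir l))
                    (trans (sign-nonempty-cycle (cells-unique l) (cells-∈⁺ l (proj₂ (nonempty l))))
                      (cong (not ∘ odd) (trans (length-map (emb l) (positions (P l))) (length-positions (P l)))))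

    allCells : List X
    allCells = concat (tabulate cells)

    allCells-∈⁺ : ∀ l {z} → z ∈ₗ cells l → z ∈ₗ allCells
    allCells-∈⁺ l z∈ = ∈-concat⁺′ z∈ (∈-tabulate⁺ l)

    allCells-∈⁻ : ∀ {z} → z ∈ₗ allCells → ∃[ l ] z ∈ₗ cells l
    allCells-∈⁻ z∈ with ∈-concat⁻′ (tabulate cells) z∈
    ... | L , z∈L , L∈ with ∈-tabulate⁻ L∈
    ...   | l , refl = l , z∈L

    allCells-unique : Unique allCells
    allCells-unique = Uniqueₚ.concat⁺ (Allₚ.tabulate⁺ cells-unique) (AllPairsₚ.tabulate⁺ disjoint)
      where
        disjoint : ∀ {l l′} → ¬ l ≡ l′ → Disjoint (cells l) (cells l′)
        disjoint l≢l′ (z∈ , z∈′) = l≢l′ (trans (sym (cells-line _ z∈)) (cells-line _ z∈′))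

    length-allCells : length allCells ≡ ∑ (λ l → ∑ (λ a → if P l a then 1 else 0))
    length-allCells = trans (length-concat-tabulate cells)
      (∑-cong (λ l → trans (length-map (emb l) (positions (P l))) (length-positions (P l))))

iter-invariant : ∀ {X : Set} {S : X → X → Set} (Q : X → Set) →
                 (∀ {a b} → S a b → (Q a → Q b) × (Q b → Q a)) →
                 ∀ {t x y} → Iter S t x y → (Q x → Q y) × (Q y → Q x)
iter-invariant Q step iter-zero          = id , id
iter-invariant Q step (iter-suc s rest) with step s | iter-invariant Q step rest
... | fwd , bwd | fwd′ , bwd′ = fwd′ ∘ fwd , bwd ∘ bwd′

module MovePermutation {n m : ℕ} (A : Array n m) (R : Fin n → Sign) (C : Fin m → Sign) where

  open FiniteSign (n * m) (λ c → combine (proj₁ c) (proj₂ c)) (remQuot {n} m)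
                  (λ c → remQuot-combine (proj₁ c) (proj₂ c)) (combine-remQuot {n} m)

  module Rows = Lines (λ i j → A i j) (λ i j → (i , j)) proj₁ (λ _ _ → refl) (λ _ → cong proj₂) R
  module Cols = Lines (λ j i → A i j) (λ j i → (i , j)) proj₂ (λ _ _ → refl) (λ _ → cong proj₁) C

  move : Perm (Cell n m)
  move = Cols.perm ⊙ Rows.perm

  row-step : ∀ t {i j j′} → Pow± (RowSucc A) t (i , j) (i , j′) → Pow± (NextOn (A i)) t j j′
  row-step Sg.+ = proj₂
  row-step Sg.- = proj₂

  col-step : ∀ t {i j} e → Pow± (ColSucc A) t (i , j) e →
             proj₂ e ≡ j × Pow± (NextOn (λ r → A r j)) t i (proj₁ e)
  col-step Sg.+ (i′ , j′) (refl , next) = refl , next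
  col-step Sg.- (i′ , j′) (refl , next) = refl , next

  Move⇒move : ∀ c e → Move A R C c e → e ≡ to move c
  Move⇒move (i , j) (i′ , j″) (j′ , row , col) with col-step (C j′) (i′ , j″) col
  ... | refl , col′ = begin
      (i′ , j′)                            ≡⟨ Cols.step⇒cycle j′ (C j′) col′ ⟩
      to (Cols.σ j′) (i , j′)              ≡⟨ sym (Cols.perm-on-line (i , j′)) ⟩
      to Cols.perm (i , j′)                ≡⟨ cong (to Cols.perm) (Rows.step⇒cycle i (R i) (row-step (R i) row)) ⟩
      to Cols.perm (to (Rows.σ i) (i , j)) ≡⟨ cong (to Cols.perm) (sym (Rows.perm-on-line (i , j))) ⟩
      to move (i , j)                      ∎
    where open ≡-Reasoning

  open Iterates (to move)

  Iter⇒iterate : ∀ {t x y} → Iter (Move A R C) t x y → (f^ t) x ≡ y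
  Iter⇒iterate iter-zero = refl
  Iter⇒iterate (iter-suc {t = t} {x = x} {y = y} step rest) =
    trans (cong (f^ t) (sym (Move⇒move x y step))) (Iter⇒iterate rest)

  filled? : ∀ z → Dec (Filled A z)
  filled? z = A (proj₁ z) (proj₂ z) ≟ᵇ true

  -- Empty cells lie on no line, so move fixes them.
  move-fixes-empty : ∀ z → ¬ Filled A z → to move z ≡ z
  move-fixes-empty z empty = trans (cong (to Cols.perm) (Rows.perm-fixes z off-rows)) (Cols.perm-fixes z off-cols)
    where
      off-rows : ∀ i → z ∉ₗ Rows.cells i
      off-rows i z∈ with Rows.cells-∈⁻ i z∈
      ... | _ , refl , filled = empty filled
      off-cols : ∀ j → z ∉ₗ Cols.cells j
      off-cols j z∈ with Cols.cells-∈⁻ j z∈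
      ... | _ , refl , filled = empty filled

  -- If S_{R,C} is a single cycle through the filled cells, then its sign is
  -- |F(A)| - 1 mod 2, while as a product of row and column cycles it has sign
  -- (|F(A)| - n) + (|F(A)| - m): hence |F(A)| ≡ m + n - 1 mod 2.
  module SingleCycle (x : Cell n m) (fx : Filled A x)
                     (cover : ∀ y → Filled A y → ∃[ t ] Iter (Move A R C) t x y) where

    reach : ∀ y → Filled A y → ∃[ t ] (f^ t) x ≡ y
    reach y fy = proj₁ (cover y fy) , Iter⇒iterate (proj₂ (cover y fy))

    -- x is periodic, since it is reached from its preimage, which is filled.
    periodic : ∃[ t ] (f^ suc t) x ≡ x
    periodic with filled? (from move x)
    ... | no empty = ⊥-elim (empty (subst (Filled A) (trans (sym (to-from move x)) (move-fixes-empty _ empty)) fx))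
    ... | yes preimage-filled with reach (from move x) preimage-filled
    ...   | t , e = t , trans (f^-suc t x) (trans (cong (to move) e) (to-from move x))

    open Orbit (to move) (to-injective move) _≟X_ x (proj₁ periodic) (proj₂ periodic)

    -- move fixes the empty cells, so it maps filled cells to filled cells.
    orbit-filled : ∀ {z} → z ∈ₗ orbit → Filled A z
    orbit-filled z∈ with orbit-∈ z∈
    ... | t , refl = f^-preserves (Filled A) preserves t x fx
      where
        preserves : ∀ z → Filled A z → Filled A (to move z)
        preserves = fixing-complement-preserves (Filled A) filled? move move-fixes-empty

    -- Since the orbit of x contains every filled cell, move is the cycle of that orbit.
    move-is-orbit-cycle : ∀ z → to move z ≡ to (cycle orbit) z
    move-is-orbit-cycle z with filled? z
    ... | yes fz with reach z fz
    ...   | t , refl = sym (cycle-follows orbit orbit-unique (orbit-follows t))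
    move-is-orbit-cycle z | no empty =
      trans (move-fixes-empty z empty) (sym (cycle-fixes orbit z (empty ∘ orbit-filled)))

    -- The orbit lists the filled cells, as do the rows.
    length-orbit : length orbit ≡ numFilled A
    length-orbit =
      trans (↭-length (∼bag⇒↭ (unique∧set⇒bag orbit-unique Rows.allCells-unique (mk⇔ to-rows from-rows))))
            Rows.length-allCells
      where
        to-rows : ∀ {z} → z ∈ₗ orbit → z ∈ₗ Rows.allCells
        to-rows z∈ = Rows.allCells-∈⁺ _ (Rows.cells-∈⁺ _ (orbit-filled z∈))
        from-rows : ∀ {z} → z ∈ₗ Rows.allCells → z ∈ₗ orbit
        from-rows z∈ with Rows.allCells-∈⁻ z∈
        ... | i , z∈row with Rows.cells-∈⁻ i z∈row
        ...   | j , refl , fz with reach (i , j) fz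
        ...     | t , e = subst (_∈ₗ orbit) e (follows-∈ˡ (orbit-follows t))

    sign-move : sign move ≡ not (odd (numFilled A))
    sign-move = trans (sign-cong move (cycle orbit) move-is-orbit-cycle)
                      (trans (sign-nonempty-cycle orbit-unique (here refl)) (cong (not ∘ odd) length-orbit))

    odd-numFilled : (∀ i → ∃[ j ] (A i j ≡ true)) → (∀ j → ∃[ i ] (A i j ≡ true)) →
                    odd (numFilled A) ≡ not (odd m xor odd n)
    odd-numFilled rows-nonempty cols-nonempty =
      trans (sym (not-involutive (odd F))) (cong not (begin
        not (odd F)                                      ≡⟨ sym sign-move ⟩
        sign move                                        ≡⟨ sign-⊙ Cols.perm Rows.perm ⟩
        sign Cols.perm xor sign Rows.perm                ≡⟨ cong₂ _xor_ (Cols.sign-perm cols-nonempty)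
                                                                        (Rows.sign-perm rows-nonempty) ⟩
        (odd m xor odd F′) xor (odd n xor odd F)         ≡⟨ cong (λ c → (odd m xor odd c) xor (odd n xor odd F))
                                                                 (sym (∑-comm (λ i j → if A i j then 1 else 0))) ⟩
        (odd m xor odd F) xor (odd n xor odd F)          ≡⟨ cong ((odd m xor odd F) xor_) (xor-comm (odd n) (odd F)) ⟩
        (odd m xor odd F) xor (odd F xor odd n)          ≡⟨ xor-telescope (odd m) (odd F) (odd n) ⟩
        odd m xor odd n                                  ∎))
      where
        open ≡-Reasoning
        F F′ : ℕ
        F  = numFilled A
        F′ = ∑ (λ j → ∑ (λ i → if A i j then 1 else 0))

  -- A closed subarray is a union of orbits of S_{R,C}: a move starts in a row of
  -- the subarray iff it ends in one, since both the intermediate cell and the end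
  -- cell are filled cells of the column visited in between.
  module ClosedSubarray (Rs : Subset n) (Cs : Subset m) (closed : Closed A Rs Cs) where

    InRows : Cell n m → Set
    InRows z = proj₁ z ∈ Rs

    move-stays : ∀ {c e} → Move A R C c e → (InRows c → InRows e) × (InRows e → InRows c)
    move-stays {i , j} {i′ , j″} (j′ , row , col) with col-step (C j′) (i′ , j″) col
    ... | refl , col′ = forward , backward
      where
        middle-filled : A i j′ ≡ true
        middle-filled = step-target (A i) (R i) (row-step (R i) row)
        end-filled : A i′ j′ ≡ true
        end-filled = step-target (λ r → A r j′) (C j′) col′
        forward : i ∈ Rs → i′ ∈ Rs
        forward i∈ = proj₁ (closed i′ j′ end-filled (inj₂ (proj₂ (closed i j′ middle-filled (inj₁ i∈)))))
        backward : i′ ∈ Rs → i ∈ Rs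
        backward i′∈ = proj₁ (closed i j′ middle-filled (inj₂ (proj₂ (closed i′ j′ end-filled (inj₁ i′∈)))))

    everything : IsSolution A R C → (∀ i → ∃[ j ] (A i j ≡ true)) → (∀ j → ∃[ i ] (A i j ≡ true)) →
                 (∃[ i ] ∃[ j ] (i ∈ Rs × j ∈ Cs × A i j ≡ true)) → (∀ i → i ∈ Rs) × (∀ j → j ∈ Cs)
    everything (x , _ , cover) rows-nonempty cols-nonempty (i₀ , _ , i₀∈ , _ , filled₀) = all-rows , all-cols
      where
        path : ∀ {y} → Filled A y → (InRows x → InRows y) × (InRows y → InRows x)
        path fy = iter-invariant InRows move-stays (proj₂ (cover _ fy))
        all-rows : ∀ i → i ∈ Rs
        all-rows i = proj₁ (path (proj₂ (rows-nonempty i))) (proj₂ (path filled₀) i₀∈)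
        all-cols : ∀ j → j ∈ Cs
        all-cols j = proj₂ (closed _ j (proj₂ (cols-nonempty j)) (inj₁ (all-rows _)))

theorem2p7 : ∀ (n m : ℕ) (A : Array n m) →
    (∀ (i : Fin n) → ∃[ j ] (A i j ≡ true)) →
    (∀ (j : Fin m) → ∃[ i ] (A i j ≡ true)) →
    HasSolution A →
    ((∀ (Rs : Subset n) (Cs : Subset m) → Closed A Rs Cs →
        (∃[ i ] ∃[ j ] (i ∈ Rs × j ∈ Cs × A i j ≡ true)) →
        (∀ i → i ∈ Rs) × (∀ j → j ∈ Cs))
     × (numFilled A % 2 ≡ (m + n ∸ 1) % 2))
theorem2p7 n m A rows-nonempty cols-nonempty (R , C , solution@(x , fx , cover)) =
  minimal , parity
  where
    open MovePermutation A R C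
    minimal : ∀ Rs Cs → Closed A Rs Cs → (∃[ i ] ∃[ j ] (i ∈ Rs × j ∈ Cs × A i j ≡ true)) →
              (∀ i → i ∈ Rs) × (∀ j → j ∈ Cs)
    minimal Rs Cs closed = ClosedSubarray.everything Rs Cs closed solution rows-nonempty cols-nonempty
    1≤n : 1 ≤ n
    1≤n = ℕP.≤-trans (s≤s z≤n) (toℕ<n (proj₁ x))
    parity : numFilled A % 2 ≡ (m + n ∸ 1) % 2
    parity = same-parity⇒%2 {numFilled A} {m + n ∸ 1}
      (trans (SingleCycle.odd-numFilled x fx cover rows-nonempty cols-nonempty) (sym (odd-+∸1 m n 1≤n)))
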